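{- Every $\mathfrak S$-type is continuously searchable.
   Context: $\mathfrak S$-types are defined inductively: every finite non-empty type is an $\mathfrak S$-type; if $S,S'$ are $\mathfrak S$-types then so is $S\times S'$; if $S$ is an $\mathfrak S$-type then so is $\mathbb N\to S$. The exactness type $E(S)$: $E(F)=\mathbf 1$ for finite $F$; $E(S\times S')=E(S)\times E(S')$; $E(\mathbb N\to S)=\mathbb N\times E(S)$. Equality with precision $p\in E(S)$, $x\equiv_p y$: for finite types iff $x=y$; for products componentwise, $(x_1,x_2)\equiv_{(p_1,p_2)}(y_1,y_2)$ iff $x_i\equiv_{p_i}y_i$; for sequences, $\alpha\equiv_{(m,p)}\beta$ iff $\alpha(i)\equiv_p\beta(i)$ for all $i<m$. A predicate $Q$ on $S$ is continuous if there is $q\in E(S)$ such that $x\equiv_q x'$ and $Q(x)$ imply $Q(x')$; it is detachable if it is decidable. A searcher on $S$ is a function $\mathscr E$ assigning to each detachable continuous predicate $Q$ on $S$ an element $\mathscr E(Q)\in S$ such that if some $x\in S$ satisfies $Q$ then $Q(\mathscr E(Q))$ holds. For predicates $P,Q$ on $S$ and $p\in E(S)$, $P\Leftrightarrow_p Q$ means that for all $x,x'$ with $x\equiv_p x'$, $P(x)$ holds iff $Q(x')$ holds. A searcher is continuous if $P\Leftrightarrow_p Q$ implies $\mathscr E(P)\equiv_p\mathscr E(Q)$ for all detachable continuous $P,Q$ and all $p$. An $\mathfrak S$-type is continuously searchable if it has a continuous searcher. -}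

module Defs where

open import Data.Nat using (ℕ; _<_)
open import Data.Fin using (Fin)
open import Data.Unit using (⊤)
open import Data.Product using (Σ; _×_; _,_)
open import Relation.Nullary using (Dec)
open import Relation.Binary.PropositionalEquality using (_≡_)

-- Codes for 𝔖-types.  A finite non-empty type is represented by Fin (suc n).
data SType : Set where
  fin  : ℕ → SType
  _⊗_  : SType → SType → SType
  seq  : SType → SType

El : SType → Set
El (fin n)   = Fin (ℕ.suc n)
El (S ⊗ S')  = El S × El S'
El (seq S)   = ℕ → El S

E : SType → Set
E (fin n)   = ⊤
E (S ⊗ S')  = E S × E S'
E (seq S)   = ℕ × E S

EqP : (S : SType) → El S → E S → El S → Set
EqP (fin n)  x _ y = x ≡ y
EqP (S ⊗ S') (x₁ , x₂) (p₁ , p₂) (y₁ , y₂) = EqP S x₁ p₁ y₁ × EqP S' x₂ p₂ y₂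
EqP (seq S)  α (m , p) β = (i : ℕ) → i < m → EqP S (α i) p (β i)

Continuous : (S : SType) → (El S → Set) → Set
Continuous S Q = Σ (E S) λ q → (x x' : El S) → EqP S x q x' → Q x → Q x'

Detachable : (S : SType) → (El S → Set) → Set
Detachable S Q = (x : El S) → Dec (Q x)

record DCPred (S : SType) : Set₁ where
  field
    pred       : El S → Set
    detachable : Detachable S pred
    continuous : Continuous S pred
open DCPred public

EquivP : (S : SType) → (El S → Set) → E S → (El S → Set) → Set
EquivP S P p Q = (x x' : El S) → EqP S x p x' → (P x → Q x') × (Q x' → P x)

IsSearcher : (S : SType) → (DCPred S → El S) → Set₁
IsSearcher S 𝓔 = (Q : DCPred S) → Σ (El S) (pred Q) → pred Q (𝓔 Q)

IsContinuousSearcher : (S : SType) → (DCPred S → El S) → Set₁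
IsContinuousSearcher S 𝓔 =
  (P Q : DCPred S) (p : E S) → EquivP S (pred P) p (pred Q) → EqP S (𝓔 P) p (𝓔 Q)

ContinuouslySearchable : SType → Set₁
ContinuouslySearchable S =
  Σ (DCPred S → El S) λ 𝓔 → IsSearcher S 𝓔 × IsContinuousSearcher S 𝓔

-- On S × S' it searches S for
-- x ↦ Q (x , 𝓔' Qₓ), where Qₓ is the section of Q at x, and then searches the
-- section at the element found.  A predicate Q on sequences with modulus
-- (k , q) reads only the first k entries; its search is x₀ ∷ (search of the
-- tail predicate at x₀), where x₀ is found by searching x ↦ Q (x ∷ search of
-- the tail predicate at x).  The tail predicates have modulus (k ∸ 1 , q), and
-- with modulus (0 , q) the predicate is constant.  Continuity is proved by
-- induction on the precision; for sequences it is mutually recursive with the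
-- searcher, since the head predicate is continuous only because the search of
-- the tails is.
module Submission where

open import Defs
open import Data.Nat using (ℕ; zero; suc; s≤s) renaming (pred to predℕ)
open import Data.Fin using (Fin; zero; suc)
open import Data.Product using (∃; _,_; proj₁; proj₂)
open import Data.Empty using (⊥-elim)
open import Function using (_∘_)
open import Function.Bundles using (_⇔_; mk⇔; Equivalence)
open import Function.Properties.Equivalence using (⇔-isEquivalence)
open import Level using (0ℓ)
open import Relation.Binary.Structures using (IsEquivalence)
open import Relation.Nullary using (yes; no)
open import Relation.Unary using (Decidable)
open import Relation.Binary.PropositionalEquality
  using (_≡_; _≗_; refl; sym; cong; subst₂)

module ⇔ = IsEquivalence (⇔-isEquivalence {ℓ = 0ℓ})
open Equivalence using (to; from)

EqP-refl : ∀ {S} x {p} → EqP S x p x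
EqP-refl {fin n}   x       = refl
EqP-refl {S ⊗ S'} (x , y)  = EqP-refl x , EqP-refl y
EqP-refl {seq S}   α       = λ i _ → EqP-refl (α i)

EqP-sym : ∀ {S x p y} → EqP S x p y → EqP S y p x
EqP-sym {fin n}  e        = sym e
EqP-sym {S ⊗ S'} (e , e') = EqP-sym e , EqP-sym e'
EqP-sym {seq S}  e        = λ i i<m → EqP-sym (e i i<m)

EquivP⇒⇔ : ∀ {S P p Q x x'} → EquivP S P p Q → EqP S x p x' → P x ⇔ Q x'
EquivP⇒⇔ h e = mk⇔ (proj₁ (h _ _ e)) (proj₂ (h _ _ e))

⇔⇒EquivP : ∀ {S P p Q} → (∀ {x x'} → EqP S x p x' → P x ⇔ Q x') → EquivP S P p Q
⇔⇒EquivP f x x' e = to (f e) , from (f e)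

stable⇒EquivP-self : ∀ {S} {P : El S → Set} {p} →
                   (∀ x x' → EqP S x p x' → P x → P x') → EquivP S P p P
stable⇒EquivP-self stable x x' e = stable x x' e , stable x' x (EqP-sym e)

modulus : ∀ {S} → DCPred S → E S
modulus Q = proj₁ (continuous Q)

stable : ∀ {S} (Q : DCPred S) x x' → EqP S x (modulus Q) x' → pred Q x → pred Q x'
stable Q = proj₂ (continuous Q)

first : ∀ {n} {P : Fin (suc n) → Set} → Decidable P → Fin (suc n)
first {zero}  P? = zero
first {suc n} P? with P? zero
... | yes _ = zero
... | no  _ = suc (first (P? ∘ suc))

first-satisfies : ∀ {n} {P : Fin (suc n) → Set} (P? : Decidable P) → ∃ P → P (first P?)
first-satisfies {zero}  P? (zero , Px) = Px
first-satisfies {suc n} P? (x , Px) with P? zero | x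
... | yes P0 | _     = P0
... | no ¬P0 | zero  = ⊥-elim (¬P0 Px)
... | no ¬P0 | suc y = first-satisfies (P? ∘ suc) (y , Px)

first-cong : ∀ {n} {P Q : Fin (suc n) → Set} (P? : Decidable P) (Q? : Decidable Q) →
             (∀ x → P x ⇔ Q x) → first P? ≡ first Q?
first-cong {zero}  P? Q? P⇔Q = refl
first-cong {suc n} P? Q? P⇔Q with P? zero | Q? zero
... | yes _  | yes _  = refl
... | yes P0 | no ¬Q0 = ⊥-elim (¬Q0 (to (P⇔Q zero) P0))
... | no ¬P0 | yes Q0 = ⊥-elim (¬P0 (from (P⇔Q zero) Q0))
... | no _   | no _   = cong suc (first-cong (P? ∘ suc) (Q? ∘ suc) (P⇔Q ∘ suc))

fin-searchable : ∀ n → ContinuouslySearchable (fin n)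
fin-searchable n =
  (λ Q → first (detachable Q)) ,
  (λ Q → first-satisfies (detachable Q)) ,
  (λ P Q _ h → first-cong (detachable P) (detachable Q) (λ x → EquivP⇒⇔ h refl))

module ProductSearch {S S' : SType} (𝓔₁ : DCPred S → El S) (𝓔₂ : DCPred S' → El S')
                     (𝓔₂-continuous : IsContinuousSearcher S' 𝓔₂) where

  section : DCPred (S ⊗ S') → El S → DCPred S'
  section Q x = record
    { pred       = λ y → pred Q (x , y)
    ; detachable = λ y → detachable Q (x , y)
    ; continuous = proj₂ (modulus Q) , λ y y' e → stable Q (x , y) (x , y') (EqP-refl x , e)
    }

  section-equiv : ∀ (P Q : DCPred (S ⊗ S')) {p₁ p₂ x x'} →
                  EquivP (S ⊗ S') (pred P) (p₁ , p₂) (pred Q) → EqP S x p₁ x' →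
                  EquivP S' (pred (section P x)) p₂ (pred (section Q x'))
  section-equiv P Q h e y y' e' = h _ _ (e , e')

  projected : DCPred (S ⊗ S') → DCPred S
  projected Q = record
    { pred       = λ x → pred Q (x , 𝓔₂ (section Q x))
    ; detachable = λ x → detachable Q (x , 𝓔₂ (section Q x))
    ; continuous = proj₁ (modulus Q) , λ x x' e → stable Q _ _
        (e , 𝓔₂-continuous _ _ _ (section-equiv Q Q (stable⇒EquivP-self (stable Q)) e))
    }

  search : DCPred (S ⊗ S') → El (S ⊗ S')
  search Q = x₀ , 𝓔₂ (section Q x₀)
    where x₀ = 𝓔₁ (projected Q)

  search-correct : IsSearcher S 𝓔₁ → IsSearcher S' 𝓔₂ → IsSearcher (S ⊗ S') search
  search-correct searches₁ searches₂ Q ((x , y) , Qxy) =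
    searches₁ (projected Q) (x , searches₂ (section Q x) (y , Qxy))

  search-continuous : IsContinuousSearcher S 𝓔₁ → IsContinuousSearcher (S ⊗ S') search
  search-continuous 𝓔₁-continuous P Q (p₁ , p₂) h =
    x₀-eq , 𝓔₂-continuous _ _ p₂ (section-equiv P Q h x₀-eq)
    where
    x₀-eq : EqP S (𝓔₁ (projected P)) p₁ (𝓔₁ (projected Q))
    x₀-eq = 𝓔₁-continuous _ _ p₁ λ x x' e →
      h _ _ (e , 𝓔₂-continuous _ _ p₂ (section-equiv P Q h e))

⊗-searchable : ∀ {S S'} → ContinuouslySearchable S → ContinuouslySearchable S' →
               ContinuouslySearchable (S ⊗ S')
⊗-searchable (𝓔₁ , searches₁ , continuous₁) (𝓔₂ , searches₂ , continuous₂) =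
  search , search-correct searches₁ searches₂ , search-continuous continuous₁
  where open ProductSearch 𝓔₁ 𝓔₂ continuous₂

_∷_ : {A : Set} → A → (ℕ → A) → ℕ → A
(x ∷ α) zero    = x
(x ∷ α) (suc i) = α i

tail : {A : Set} → (ℕ → A) → ℕ → A
tail α = α ∘ suc

∷-EqP : ∀ {S x p x' α n α'} → EqP S x p x' → EqP (seq S) α (n , p) α' →
        EqP (seq S) (x ∷ α) (suc n , p) (x' ∷ α')
∷-EqP e e' zero    _       = e
∷-EqP e e' (suc i) (s≤s l) = e' i l

head∷tail-EqP : ∀ {S} α {n p} → EqP (seq S) α (n , p) (α 0 ∷ tail α)
head∷tail-EqP α zero    _ = EqP-refl (α 0)
head∷tail-EqP α (suc i) _ = EqP-refl (α (suc i))

EqP-resp-≗ : ∀ {S α α' β β' p} → α ≗ α' → β ≗ β' →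
             EqP (seq S) α p β → EqP (seq S) α' p β'
EqP-resp-≗ {S} {p = _ , p} α≗α' β≗β' e i l =
  subst₂ (λ a b → EqP S a p b) (α≗α' i) (β≗β' i) (e i l)

module SequenceSearch {S : SType} (𝓔 : DCPred S → El S)
                      (𝓔-continuous : IsContinuousSearcher S 𝓔) where

  head∷tail-continuous :
    ∀ {P Q : El (seq S) → Set} {H₁ H₂ : DCPred S} {t₁ t₂ : El S → El (seq S)} {n p} →
    (∀ x → pred H₁ x ⇔ P (x ∷ t₁ x)) → (∀ x → pred H₂ x ⇔ Q (x ∷ t₂ x)) →
    EquivP (seq S) P (suc n , p) Q →
    (∀ {x x'} → EqP S x p x' → EqP (seq S) (t₁ x) (n , p) (t₂ x')) →
    EqP (seq S) (𝓔 H₁ ∷ t₁ (𝓔 H₁)) (suc n , p) (𝓔 H₂ ∷ t₂ (𝓔 H₂))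
  head∷tail-continuous {H₁ = H₁} {H₂} {p = p} H₁-holds H₂-holds P⇔Q tails-eq =
    ∷-EqP heads-eq (tails-eq heads-eq)
    where
    heads-eq : EqP S (𝓔 H₁) p (𝓔 H₂)
    heads-eq = 𝓔-continuous _ _ p (⇔⇒EquivP λ e →
      ⇔.trans (H₁-holds _)
              (⇔.trans (EquivP⇒⇔ P⇔Q (∷-EqP e (tails-eq e))) (⇔.sym (H₂-holds _))))

  record PredMod (k : ℕ) (q : E S) : Set₁ where
    field
      holds        : El (seq S) → Set
      holds?       : Detachable (seq S) holds
      holds-stable : ∀ α β → EqP (seq S) α (k , q) β → holds α → holds β
  open PredMod

  PredMod₀-constant : ∀ {q} (Q : PredMod 0 q) {α β} → holds Q α ⇔ holds Q β
  PredMod₀-constant Q = mk⇔ (holds-stable Q _ _ λ _ ()) (holds-stable Q _ _ λ _ ())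

  restrict : ∀ {k q} → El S → PredMod (suc k) q → PredMod k q
  restrict x Q = record
    { holds        = λ α → holds Q (x ∷ α)
    ; holds?       = λ α → holds? Q (x ∷ α)
    ; holds-stable = λ α β e → holds-stable Q _ _ (∷-EqP (EqP-refl x) e)
    }

  tailPred : ∀ {k q} → El S → PredMod k q → PredMod (predℕ k) q
  tailPred {zero}  _ Q = Q
  tailPred {suc k} x Q = restrict x Q

  tailPred-holds : ∀ {k q} x (Q : PredMod k q) α → holds (tailPred x Q) α ⇔ holds Q (x ∷ α)
  tailPred-holds {zero}  x Q α = PredMod₀-constant Q
  tailPred-holds {suc k} x Q α = ⇔.refl

  tailPred-equiv : ∀ {k₁ k₂ q₁ q₂ n p x x'} (P : PredMod k₁ q₁) (Q : PredMod k₂ q₂) →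
                   EquivP (seq S) (holds P) (suc n , p) (holds Q) → EqP S x p x' →
                   EquivP (seq S) (holds (tailPred x P)) (n , p) (holds (tailPred x' Q))
  tailPred-equiv P Q h e = ⇔⇒EquivP λ e' →
    ⇔.trans (tailPred-holds _ P _)
            (⇔.trans (EquivP⇒⇔ h (∷-EqP e e')) (⇔.sym (tailPred-holds _ Q _)))

  search            : ∀ {k q} → PredMod k q → El (seq S)
  headPred          : ∀ {k q} → PredMod k q → DCPred S
  tailSearch        : ∀ {k q} → PredMod k q → El S → El (seq S)
  search-continuous : ∀ {k₁ k₂ q₁ q₂ n p} (P : PredMod k₁ q₁) (Q : PredMod k₂ q₂) →
                      EquivP (seq S) (holds P) (n , p) (holds Q) →
                      EqP (seq S) (search P) (n , p) (search Q)

  search {zero}  Q = λ _ → 𝓔 (headPred Q)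
  search {suc k} Q = let x₀ = 𝓔 (headPred Q) in x₀ ∷ search (restrict x₀ Q)

  headPred {zero} {q} Q = record
    { pred       = λ x → holds Q (λ _ → x)
    ; detachable = λ x → holds? Q (λ _ → x)
    ; continuous = q , λ x x' _ → to (PredMod₀-constant Q)
    }
  headPred {suc k} {q} Q = record
    { pred       = λ x → holds Q (x ∷ search (restrict x Q))
    ; detachable = λ x → holds? Q (x ∷ search (restrict x Q))
    ; continuous = q , λ x x' e → holds-stable Q _ _ (∷-EqP e
        (search-continuous (restrict x Q) (restrict x' Q)
          (tailPred-equiv Q Q (stable⇒EquivP-self (holds-stable Q)) e)))
    }

  tailSearch {zero}  Q _ = search Q
  tailSearch {suc k} Q x = search (restrict x Q)

  search-unfold : ∀ {k q} (Q : PredMod k q) →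
                  search Q ≗ (𝓔 (headPred Q) ∷ tailSearch Q (𝓔 (headPred Q)))
  search-unfold {zero}  Q zero    = refl
  search-unfold {zero}  Q (suc i) = refl
  search-unfold {suc k} Q i       = refl

  headPred-holds : ∀ {k q} (Q : PredMod k q) x →
                   pred (headPred Q) x ⇔ holds Q (x ∷ tailSearch Q x)
  headPred-holds {zero}  Q x = PredMod₀-constant Q
  headPred-holds {suc k} Q x = ⇔.refl

  search-continuous-step :
    ∀ {k₁ k₂ q₁ q₂ n p} (P : PredMod k₁ q₁) (Q : PredMod k₂ q₂) →
    EquivP (seq S) (holds P) (suc n , p) (holds Q) →
    (∀ {x x'} → EqP S x p x' → EqP (seq S) (tailSearch P x) (n , p) (tailSearch Q x')) →
    EqP (seq S) (search P) (suc n , p) (search Q)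
  search-continuous-step P Q h tails-eq =
    EqP-resp-≗ (sym ∘ search-unfold P) (sym ∘ search-unfold Q)
      (head∷tail-continuous (headPred-holds P) (headPred-holds Q) h tails-eq)

  -- The split on the levels is only there for the termination checker, which
  -- does not see that the tail predicates have smaller levels (predℕ k).
  search-continuous {n = zero} P Q h = λ _ ()
  search-continuous {zero} {zero} {n = suc n} P Q h =
    search-continuous-step P Q h λ e →
      search-continuous P Q (tailPred-equiv P Q h e)
  search-continuous {zero} {suc k₂} {n = suc n} P Q h =
    search-continuous-step P Q h λ e →
      search-continuous P (restrict _ Q) (tailPred-equiv P Q h e)
  search-continuous {suc k₁} {zero} {n = suc n} P Q h =
    search-continuous-step P Q h λ e →
      search-continuous (restrict _ P) Q (tailPred-equiv P Q h e)
  search-continuous {suc k₁} {suc k₂} {n = suc n} P Q h =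
    search-continuous-step P Q h λ e →
      search-continuous (restrict _ P) (restrict _ Q) (tailPred-equiv P Q h e)

  search-correct : IsSearcher S 𝓔 → ∀ {k q} (Q : PredMod k q) α → holds Q α → holds Q (search Q)
  search-correct _ {zero} Q α Qα = to (PredMod₀-constant Q) Qα
  search-correct searches {suc k} Q α Qα =
    searches (headPred Q) (α 0 , search-correct searches (restrict (α 0) Q) (tail α)
                                   (holds-stable Q α _ (head∷tail-EqP α) Qα))

  fromDCPred : (Q : DCPred (seq S)) → PredMod (proj₁ (modulus Q)) (proj₂ (modulus Q))
  fromDCPred Q = record { holds = pred Q ; holds? = detachable Q ; holds-stable = stable Q }

seq-searchable : ∀ {S} → ContinuouslySearchable S → ContinuouslySearchable (seq S)
seq-searchable (𝓔 , searches , continuous) =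
  (λ Q → search (fromDCPred Q)) ,
  (λ Q (α , Qα) → search-correct searches (fromDCPred Q) α Qα) ,
  (λ P Q _ h → search-continuous (fromDCPred P) (fromDCPred Q) h)
  where open SequenceSearch 𝓔 continuous

mainTheorem8 : (S : SType) → ContinuouslySearchable S
mainTheorem8 (fin n)  = fin-searchable n
mainTheorem8 (S ⊗ S') = ⊗-searchable (mainTheorem8 S) (mainTheorem8 S')
mainTheorem8 (seq S)  = seq-searchable (mainTheorem8 S)
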